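{- Let $R$ be a complete discrete valuation ring with maximal ideal $\mathfrak{p}=pR$ and field of fractions $F$. Fix $n\ge1$, $\gamma=\begin{pmatrix}0&1\\ p^n&0\end{pmatrix}$, $\mathcal{O}=\begin{pmatrix}R&R\\ \mathfrak{p}^n&R\end{pmatrix}$, and let $\sigma\colon\mathcal{O}^\times\to\operatorname{Sym}(\operatorname{Id}(\mathcal{O};\mathfrak{p})')$, $\omega\mapsto\sigma_\omega$, with $\sigma_\omega(P)=P\omega$. Then \[\ker(\sigma)=\left\{\begin{pmatrix}a+k_1p&bp\\ cp^{n+1}&a+k_2p\end{pmatrix}:\ a\in R^\times,\ b,c,k_1,k_2\in R\right\}.\]
   Context: $\operatorname{Id}(\mathcal{O};\mathfrak{p})$ is the set of principal left ideals of $\mathcal{O}$ of reduced norm $\mathfrak{p}$ (reduced norm $=\det$), and $\operatorname{Id}(\mathcal{O};\mathfrak{p})'$ is $\operatorname{Id}(\mathcal{O};\mathfrak{p})$ with the Jacobson radical $\operatorname{rad}(\mathcal{O})$ removed when $n=1$, and all of $\operatorname{Id}(\mathcal{O};\mathfrak{p})$ when $n\ge2$. The kernel is $\{\omega\in\mathcal{O}^\times:\sigma_\omega=\mathrm{id}\}$. -}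

module Defs where

open import Level using (Level; _⊔_)
open import Data.Nat using (ℕ; zero; suc)
open import Relation.Binary.PropositionalEquality using (_≡_)
open import Data.Product using (Σ; ∃; _×_; _,_)
open import Data.Sum using (_⊎_)
open import Relation.Nullary using (¬_)
open import Algebra.Bundles using (CommutativeRing)

_⇔ₚ_ : ∀ {a b} → Set a → Set b → Set (a ⊔ b)
A ⇔ₚ B = (A → B) × (B → A)

module _ {c ℓ : Level} (R : CommutativeRing c ℓ) where
  open CommutativeRing R

  pow : Carrier → ℕ → Carrier
  pow x zero    = 1#
  pow x (suc k) = x * pow x k

  IsUnit : Carrier → Set (c ⊔ ℓ)
  IsUnit u = Σ Carrier λ v → u * v ≈ 1#

  _∣ᴿ_ : Carrier → Carrier → Set (c ⊔ ℓ)
  y ∣ᴿ x = Σ Carrier λ r → x ≈ y * r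

  -- R is a complete discrete valuation ring with uniformizer p
  -- (so its maximal ideal is 𝔭 = pR).
  record IsCompleteDVR (p : Carrier) : Set (c ⊔ ℓ) where
    field
      nontrivial   : ¬ (1# ≈ 0#)
      noZeroDivisors : ∀ x y → x * y ≈ 0# → x ≈ 0# ⊎ y ≈ 0#
      p-nonzero    : ¬ (p ≈ 0#)
      p-nonunit    : ¬ IsUnit p
      valuation    : ∀ x → x ≈ 0# ⊎ Σ Carrier (λ u → Σ ℕ λ k → IsUnit u × x ≈ u * pow p k)
      -- 𝔭-adic completeness: every 𝔭-adically Cauchy sequence converges
      complete     : (s : ℕ → Carrier) → (∀ k → pow p k ∣ᴿ (s (suc k) - s k)) →
                     Σ Carrier λ y → ∀ k → pow p k ∣ᴿ (y - s k)

  record Mat : Set c where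
    constructor mat
    field
      m₁₁ m₁₂ m₂₁ m₂₂ : Carrier
  open Mat public

  _≈ᴹ_ : Mat → Mat → Set ℓ
  A ≈ᴹ B = (m₁₁ A ≈ m₁₁ B) × (m₁₂ A ≈ m₁₂ B) × (m₂₁ A ≈ m₂₁ B) × (m₂₂ A ≈ m₂₂ B)

  _*ᴹ_ : Mat → Mat → Mat
  A *ᴹ B = mat (m₁₁ A * m₁₁ B + m₁₂ A * m₂₁ B) (m₁₁ A * m₁₂ B + m₁₂ A * m₂₂ B)
               (m₂₁ A * m₁₁ B + m₂₂ A * m₂₁ B) (m₂₁ A * m₁₂ B + m₂₂ A * m₂₂ B)

  _-ᴹ_ : Mat → Mat → Mat
  A -ᴹ B = mat (m₁₁ A - m₁₁ B) (m₁₂ A - m₁₂ B) (m₂₁ A - m₂₁ B) (m₂₂ A - m₂₂ B)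

  1ᴹ : Mat
  1ᴹ = mat 1# 0# 0# 1#

  -- reduced norm = determinant
  det : Mat → Carrier
  det A = m₁₁ A * m₂₂ A - m₁₂ A * m₂₁ A

  module Order (p : Carrier) (n : ℕ) where
    -- membership in 𝒪 = ( R R ; 𝔭ⁿ R )
    In𝒪 : Mat → Set (c ⊔ ℓ)
    In𝒪 A = pow p n ∣ᴿ m₂₁ A

    Unit𝒪 : Mat → Set (c ⊔ ℓ)
    Unit𝒪 A = In𝒪 A × Σ Mat λ B → In𝒪 B × (A *ᴹ B) ≈ᴹ 1ᴹ × (B *ᴹ A) ≈ᴹ 1ᴹ

    Ideal𝒪 : Mat → Mat → Set (c ⊔ ℓ)
    Ideal𝒪 α x = Σ Mat λ o → In𝒪 o × x ≈ᴹ (o *ᴹ α)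

    IdealTimes : Mat → Mat → Mat → Set (c ⊔ ℓ)
    IdealTimes α ω x = Σ Mat λ y → Ideal𝒪 α y × x ≈ᴹ (y *ᴹ ω)

    Rad : Mat → Set (c ⊔ ℓ)
    Rad x = In𝒪 x × (∀ y → In𝒪 y → Unit𝒪 (1ᴹ -ᴹ (y *ᴹ x)))

    -- nrd(𝒪α) = det(α) R equals 𝔭 = p R (as ideals of R)
    NrdIsP : Mat → Set (c ⊔ ℓ)
    NrdIsP α = ∀ x → (det α ∣ᴿ x) ⇔ₚ (p ∣ᴿ x)

    -- 𝒪α ∈ Id(𝒪;𝔭)' : α ∈ 𝒪, nrd = 𝔭, and (for n = 1) 𝒪α ≠ rad(𝒪)
    InId' : Mat → Set (c ⊔ ℓ)
    InId' α = In𝒪 α × NrdIsP α × (n ≡ 1 → ¬ (∀ x → Ideal𝒪 α x ⇔ₚ Rad x))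

    -- ω ∈ ker σ : ω ∈ 𝒪ˣ and P ω = P for every P ∈ Id(𝒪;𝔭)'
    InKer : Mat → Set (c ⊔ ℓ)
    InKer ω = Unit𝒪 ω × (∀ α → InId' α → ∀ x → IdealTimes α ω x ⇔ₚ Ideal𝒪 α x)

    KerShape : Mat → Set (c ⊔ ℓ)
    KerShape ω = Σ Carrier λ a → IsUnit a × Σ Carrier λ b → Σ Carrier λ c' →
                 Σ Carrier λ k₁ → Σ Carrier λ k₂ →
                 ω ≈ᴹ mat (a + k₁ * p) (b * p) (c' * pow p (suc n)) (a + k₂ * p)

module Submission where

-- The kernel of σ is Rˣ + p𝒪: the matrices a·1 + G·p with a ∈ Rˣ and G ∈ 𝒪.
--
-- ker σ ⊆ Rˣ + p𝒪: if ω fixes 𝒪α then αω ∈ 𝒪α.  Testing against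
-- α = diag(p,1), diag(1,p) and (1 1; 0 p) — each of determinant p, and
-- 1 - α is singular, so 𝒪α is not the radical — yields c ∈ 𝔭ⁿ⁺¹, b ∈ 𝔭 and
-- d ≡ a mod 𝔭.  The entry a is a unit since ω ∈ 𝒪ˣ and 𝔭ⁿ ⊆ 𝔭 (n ≥ 1).
--
-- Rˣ + p𝒪 ⊆ ker σ: det ω ∈ a² + 𝔭 is a unit of the DVR, so ω ∈ 𝒪ˣ with
-- inverse e·adj ω, again in Rˣ + p𝒪.  For α ∈ 𝒪 with s·det α = p the
-- adjugate gives α(a·1 + G·p) = (a·1 + (α G adj α)·s) α, a left multiple of
-- α by an element of 𝒪; applied to ω and ω⁻¹ this gives (𝒪α)ω = 𝒪α.

open import Level using (Level; _⊔_)
open import Defs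
open import Relation.Binary.Bundles using (Setoid)
import Relation.Binary.Reasoning.Setoid as SetoidReasoning
open import Relation.Nullary using (¬_)
open import Data.Empty using (⊥; ⊥-elim)
open import Data.Sum using (inj₁; inj₂)
open import Algebra.Bundles using (CommutativeRing)
open import Data.Nat as ℕ using (ℕ; zero; suc; _≤_)
import Data.Nat.Properties as ℕ
open import Data.Integer as ℤ using (ℤ; +_; -[1+_]; _⊖_; sign; ∣_∣; _◃_)
import Data.Integer.Properties as ℤ
open import Data.Sign as Sign using (Sign)
open import Data.Maybe using (just; nothing)
open import Data.Product using (Σ; _×_; _,_; proj₁; proj₂)
import Relation.Binary.PropositionalEquality as ≡
open import Relation.Binary.Definitions using (WeaklyDecidable)
open import Relation.Nullary.Decidable using (yes; no)
open import Algebra.Solver.Ring.AlmostCommutativeRing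
  using (_-Raw-AlmostCommutative⟶_; fromCommutativeRing; Induced-equivalence)
import Algebra.Solver.Ring

-- The library ring solver (Algebra.Solver.Ring) normalises polynomials with
-- coefficients from a ring whose arithmetic computes.  To use it on an
-- abstract commutative ring R we take ℤ as coefficient ring, via the
-- canonical ring homomorphism fromℤ : ℤ → R.
module IntegerSolver {c ℓ : Level} (R : CommutativeRing c ℓ) where
  open CommutativeRing R
  open import Algebra.Properties.Ring ring
  open import Algebra.Properties.Semiring.Mult.TCOptimised semiring
    using (1+×; ×-homo-+; ×1-homo-*) renaming (_×_ to _·ℕ_)
  open import Algebra.Properties.CommutativeSemigroup +-commutativeSemigroup
    using () renaming (interchange to +-interchange)
  open import Algebra.Properties.CommutativeSemigroup *-commutativeSemigroup
    using () renaming (interchange to *-interchange)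
  open SetoidReasoning setoid

  natR : ℕ → Carrier
  natR n = n ·ℕ 1#

  fromℤ : ℤ → Carrier
  fromℤ (+ n)    = natR n
  fromℤ -[1+ n ] = - natR (suc n)

  shift-difference : ∀ z x y → x - y ≈ (z + x) - (z + y)
  shift-difference z x y = begin
    x - y                     ≈⟨ +-identityˡ _ ⟨
    0# + (x - y)              ≈⟨ +-congʳ (-‿inverseʳ z) ⟨
    (z - z) + (x - y)         ≈⟨ +-interchange z x (- z) (- y) ⟨
    (z + x) + (- z - y)       ≈⟨ +-congˡ (-‿+-comm _ _) ⟩
    (z + x) - (z + y)         ∎

  -- fromℤ preserves addition, negation and multiplication; ⊖ is the
  -- subtraction of naturals through which ℤ-addition is computed.
  fromℤ-⊖ : ∀ m n → fromℤ (m ⊖ n) ≈ natR m - natR n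
  fromℤ-⊖ zero    zero    = sym (-‿inverseʳ _)
  fromℤ-⊖ zero    (suc n) = sym (+-identityˡ _)
  fromℤ-⊖ (suc m) zero    = sym (trans (+-congˡ -0#≈0#) (+-identityʳ _))
  fromℤ-⊖ (suc m) (suc n) = begin
    fromℤ (suc m ⊖ suc n)          ≡⟨ ≡.cong fromℤ (ℤ.[1+m]⊖[1+n]≡m⊖n m n) ⟩
    fromℤ (m ⊖ n)                  ≈⟨ fromℤ-⊖ m n ⟩
    natR m - natR n                ≈⟨ shift-difference 1# _ _ ⟩
    (1# + natR m) - (1# + natR n)  ≈⟨ +-cong (1+× m 1#) (-‿cong (1+× n 1#)) ⟨
    natR (suc m) - natR (suc n)    ∎

  fromℤ-+ : ∀ i j → fromℤ (i ℤ.+ j) ≈ fromℤ i + fromℤ j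
  fromℤ-+ (+ m)    (+ n)    = ×-homo-+ 1# m n
  fromℤ-+ (+ m)    -[1+ n ] = fromℤ-⊖ m (suc n)
  fromℤ-+ -[1+ m ] (+ n)    = trans (fromℤ-⊖ n (suc m)) (+-comm _ _)
  fromℤ-+ -[1+ m ] -[1+ n ] = begin
    - natR (suc (suc (m ℕ.+ n)))   ≡⟨ ≡.cong (λ k → - natR (suc k)) (ℕ.+-suc m n) ⟨
    - natR (suc m ℕ.+ suc n)       ≈⟨ -‿cong (×-homo-+ 1# (suc m) (suc n)) ⟩
    - (natR (suc m) + natR (suc n)) ≈⟨ -‿+-comm _ _ ⟨
    - natR (suc m) - natR (suc n)  ∎

  fromℤ-neg : ∀ i → fromℤ (ℤ.- i) ≈ - fromℤ i
  fromℤ-neg (+ zero)  = sym -0#≈0#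
  fromℤ-neg (+ suc n) = refl
  fromℤ-neg -[1+ n ]  = sym (-‿involutive _)

  -- Multiplication on ℤ is defined through signs and absolute values.
  signR : Sign → Carrier
  signR Sign.+ = 1#
  signR Sign.- = - 1#

  signR-* : ∀ s t → signR (s Sign.* t) ≈ signR s * signR t
  signR-* Sign.+ t       = sym (*-identityˡ _)
  signR-* Sign.- Sign.+ = sym (*-identityʳ _)
  signR-* Sign.- Sign.- = begin
    1#                ≈⟨ -‿involutive 1# ⟨
    - - 1#            ≈⟨ -‿cong (-1*x≈-x 1#) ⟨
    - (- 1# * 1#)     ≈⟨ -‿distribʳ-* _ _ ⟩
    - 1# * - 1#       ∎

  fromℤ-◃ : ∀ s n → fromℤ (s ◃ n) ≈ signR s * natR n
  fromℤ-◃ s      zero    = sym (zeroʳ _)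
  fromℤ-◃ Sign.+ (suc n) = sym (*-identityˡ _)
  fromℤ-◃ Sign.- (suc n) = sym (-1*x≈-x _)

  fromℤ-sign-abs : ∀ i → fromℤ i ≈ signR (sign i) * natR ∣ i ∣
  fromℤ-sign-abs i = trans (reflexive (≡.cong fromℤ (≡.sym (ℤ.◃-inverse i)))) (fromℤ-◃ (sign i) ∣ i ∣)

  fromℤ-* : ∀ i j → fromℤ (i ℤ.* j) ≈ fromℤ i * fromℤ j
  fromℤ-* i j = begin
    fromℤ (sign i Sign.* sign j ◃ ∣ i ∣ ℕ.* ∣ j ∣)
      ≈⟨ fromℤ-◃ (sign i Sign.* sign j) (∣ i ∣ ℕ.* ∣ j ∣) ⟩
    signR (sign i Sign.* sign j) * natR (∣ i ∣ ℕ.* ∣ j ∣)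
      ≈⟨ *-cong (signR-* (sign i) (sign j)) (×1-homo-* ∣ i ∣ ∣ j ∣) ⟩
    (signR (sign i) * signR (sign j)) * (natR ∣ i ∣ * natR ∣ j ∣)
      ≈⟨ *-interchange _ _ _ _ ⟩
    (signR (sign i) * natR ∣ i ∣) * (signR (sign j) * natR ∣ j ∣)
      ≈⟨ *-cong (fromℤ-sign-abs i) (fromℤ-sign-abs j) ⟨
    fromℤ i * fromℤ j ∎

  fromℤ-morphism : ℤ.+-*-rawRing -Raw-AlmostCommutative⟶ fromCommutativeRing R
  fromℤ-morphism = record
    { ⟦_⟧ = fromℤ ; +-homo = fromℤ-+ ; *-homo = fromℤ-* ; -‿homo = fromℤ-neg ; 0-homo = refl ; 1-homo = refl }

  _≟-coefficient_ : WeaklyDecidable (Induced-equivalence fromℤ-morphism)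
  i ≟-coefficient j with i ℤ.≟ j
  ... | yes ≡.refl = just refl
  ... | no _       = nothing

  open Algebra.Solver.Ring ℤ.+-*-rawRing (fromCommutativeRing R) fromℤ-morphism _≟-coefficient_ public
    using (Polynomial; solve; _:=_; _:+_; _:*_; :-_; _:-_; con)

  𝟘 𝟙 : ∀ {k} → Polynomial k
  𝟘 = con (+ 0)
  𝟙 = con (+ 1)

module Matrices {c ℓ : Level} (R : CommutativeRing c ℓ) where
  open CommutativeRing R
  open IntegerSolver R
  module ≈-Reasoning = SetoidReasoning setoid

  infix  4 _≈M_
  infixl 6 _+M_ _-M_
  infixl 7 _*M_
  infixr 8 _·M_

  _≈M_ : Mat R → Mat R → Set ℓ
  _≈M_ = _≈ᴹ_ R

  _*M_ : Mat R → Mat R → Mat R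
  _*M_ = _*ᴹ_ R

  _-M_ : Mat R → Mat R → Mat R
  _-M_ = _-ᴹ_ R

  1M : Mat R
  1M = 1ᴹ R

  detM : Mat R → Carrier
  detM = det R

  _+M_ : Mat R → Mat R → Mat R
  A +M B = mat (m₁₁ A + m₁₁ B) (m₁₂ A + m₁₂ B) (m₂₁ A + m₂₁ B) (m₂₂ A + m₂₂ B)

  _·M_ : Carrier → Mat R → Mat R
  s ·M A = mat (s * m₁₁ A) (s * m₁₂ A) (s * m₂₁ A) (s * m₂₂ A)

  scalarM : Carrier → Mat R
  scalarM s = mat s 0# 0# s

  adj : Mat R → Mat R
  adj A = mat (m₂₂ A) (- m₁₂ A) (- m₂₁ A) (m₁₁ A)

  affine : Carrier → Carrier → Mat R → Mat R
  affine a t G = mat (a + m₁₁ G * t) (m₁₂ G * t) (m₂₁ G * t) (a + m₂₂ G * t)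

  ≈M-refl : ∀ {A} → A ≈M A
  ≈M-refl = refl , refl , refl , refl

  ≈M-sym : ∀ {A B} → A ≈M B → B ≈M A
  ≈M-sym (e₁ , e₂ , e₃ , e₄) = sym e₁ , sym e₂ , sym e₃ , sym e₄

  ≈M-trans : ∀ {A B C} → A ≈M B → B ≈M C → A ≈M C
  ≈M-trans (e₁ , e₂ , e₃ , e₄) (f₁ , f₂ , f₃ , f₄) = trans e₁ f₁ , trans e₂ f₂ , trans e₃ f₃ , trans e₄ f₄

  matSetoid : Setoid c ℓ
  matSetoid = record
    { Carrier = Mat R ; _≈_ = _≈M_
    ; isEquivalence = record { refl = ≈M-refl ; sym = ≈M-sym ; trans = ≈M-trans } }

  module ≈M-Reasoning = SetoidReasoning matSetoid

  *M-cong : ∀ {A A′ B B′} → A ≈M A′ → B ≈M B′ → A *M B ≈M A′ *M B′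
  *M-cong (a₁ , a₂ , a₃ , a₄) (b₁ , b₂ , b₃ , b₄) =
    +-cong (*-cong a₁ b₁) (*-cong a₂ b₃) , +-cong (*-cong a₁ b₂) (*-cong a₂ b₄) ,
    +-cong (*-cong a₃ b₁) (*-cong a₄ b₃) , +-cong (*-cong a₃ b₂) (*-cong a₄ b₄)

  +M-congˡ : ∀ {A B B′} → B ≈M B′ → A +M B ≈M A +M B′
  +M-congˡ (b₁ , b₂ , b₃ , b₄) = +-congˡ b₁ , +-congˡ b₂ , +-congˡ b₃ , +-congˡ b₄

  ·M-congˡ : ∀ {s s′} A → s ≈ s′ → s ·M A ≈M s′ ·M A
  ·M-congˡ A e = *-congʳ e , *-congʳ e , *-congʳ e , *-congʳ e

  ·M-congʳ : ∀ s {A B} → A ≈M B → s ·M A ≈M s ·M B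
  ·M-congʳ s (e₁ , e₂ , e₃ , e₄) = *-congˡ e₁ , *-congˡ e₂ , *-congˡ e₃ , *-congˡ e₄

  ·M-assoc : ∀ s t A → s ·M (t ·M A) ≈M (s * t) ·M A
  ·M-assoc s t A = sym (*-assoc _ _ _) , sym (*-assoc _ _ _) , sym (*-assoc _ _ _) , sym (*-assoc _ _ _)

  adj-cong : ∀ {A B} → A ≈M B → adj A ≈M adj B
  adj-cong (e₁ , e₂ , e₃ , e₄) = e₄ , -‿cong e₂ , -‿cong e₃ , e₁

  det-cong : ∀ {A B} → A ≈M B → detM A ≈ detM B
  det-cong (e₁ , e₂ , e₃ , e₄) = +-cong (*-cong e₁ e₄) (-‿cong (*-cong e₂ e₃))

  *M-assoc : ∀ A B C → (A *M B) *M C ≈M A *M (B *M C)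
  *M-assoc (mat a₁ a₂ a₃ a₄) (mat b₁ b₂ b₃ b₄) (mat c₁ c₂ c₃ c₄) =
    entry a₁ a₂ b₁ b₂ b₃ b₄ c₁ c₃ , entry a₁ a₂ b₁ b₂ b₃ b₄ c₂ c₄ ,
    entry a₃ a₄ b₁ b₂ b₃ b₄ c₁ c₃ , entry a₃ a₄ b₁ b₂ b₃ b₄ c₂ c₄
    where
    entry : ∀ x y b₁ b₂ b₃ b₄ u v →
            (x * b₁ + y * b₃) * u + (x * b₂ + y * b₄) * v ≈ x * (b₁ * u + b₂ * v) + y * (b₃ * u + b₄ * v)
    entry = solve 8 (λ x y b₁ b₂ b₃ b₄ u v →
              (x :* b₁ :+ y :* b₃) :* u :+ (x :* b₂ :+ y :* b₄) :* v
                := x :* (b₁ :* u :+ b₂ :* v) :+ y :* (b₃ :* u :+ b₄ :* v)) refl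

  *M-identityˡ : ∀ A → 1M *M A ≈M A
  *M-identityˡ (mat a b c d) = row₁ a c , row₁ b d , row₂ a c , row₂ b d
    where
    row₁ : ∀ x y → 1# * x + 0# * y ≈ x
    row₁ = solve 2 (λ x y → 𝟙 :* x :+ 𝟘 :* y := x) refl
    row₂ : ∀ x y → 0# * x + 1# * y ≈ y
    row₂ = solve 2 (λ x y → 𝟘 :* x :+ 𝟙 :* y := y) refl

  *M-identityʳ : ∀ A → A *M 1M ≈M A
  *M-identityʳ (mat a b c d) = column₁ a b , column₂ a b , column₁ c d , column₂ c d
    where
    column₁ : ∀ x y → x * 1# + y * 0# ≈ x
    column₁ = solve 2 (λ x y → x :* 𝟙 :+ y :* 𝟘 := x) refl
    column₂ : ∀ x y → x * 0# + y * 1# ≈ y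
    column₂ = solve 2 (λ x y → x :* 𝟘 :+ y :* 𝟙 := y) refl

  det-* : ∀ A B → detM (A *M B) ≈ detM A * detM B
  det-* (mat a b c d) (mat e f g h) =
    solve 8 (λ a b c d e f g h →
      (a :* e :+ b :* g) :* (c :* f :+ d :* h) :- (a :* f :+ b :* h) :* (c :* e :+ d :* g)
        := (a :* d :- b :* c) :* (e :* h :- f :* g)) refl a b c d e f g h

  det-1 : detM 1M ≈ 1#
  det-1 = solve 0 (𝟙 :* 𝟙 :- 𝟘 :* 𝟘 := 𝟙) refl

  singular-no-inverse : ¬ (1# ≈ 0#) → ∀ {A B} → detM A ≈ 0# → A *M B ≈M 1M → ⊥
  singular-no-inverse 1≉0 {A} {B} detA≈0 AB≈1 = 1≉0 (begin
    1#                  ≈⟨ det-1 ⟨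
    detM 1M             ≈⟨ det-cong AB≈1 ⟨
    detM (A *M B)       ≈⟨ det-* A B ⟩
    detM A * detM B     ≈⟨ *-congʳ detA≈0 ⟩
    0# * detM B         ≈⟨ zeroˡ _ ⟩
    0#                  ∎)
    where open ≈-Reasoning

  *M-adj : ∀ s A → A *M (s ·M adj A) ≈M scalarM (detM A * s)
  *M-adj s (mat a b c d) =
    solve 5 (λ a b c d s → a :* (s :* d) :+ b :* (s :* :- c) := (a :* d :- b :* c) :* s) refl a b c d s ,
    solve 3 (λ a b s → a :* (s :* :- b) :+ b :* (s :* a) := 𝟘) refl a b s ,
    solve 3 (λ c d s → c :* (s :* d) :+ d :* (s :* :- c) := 𝟘) refl c d s ,
    solve 5 (λ a b c d s → c :* (s :* :- b) :+ d :* (s :* a) := (a :* d :- b :* c) :* s) refl a b c d s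

  adj-*M : ∀ s A → (s ·M adj A) *M A ≈M scalarM (detM A * s)
  adj-*M s (mat a b c d) =
    solve 5 (λ a b c d s → (s :* d) :* a :+ (s :* :- b) :* c := (a :* d :- b :* c) :* s) refl a b c d s ,
    solve 3 (λ b d s → (s :* d) :* b :+ (s :* :- b) :* d := 𝟘) refl b d s ,
    solve 3 (λ a c s → (s :* :- c) :* a :+ (s :* a) :* c := 𝟘) refl a c s ,
    solve 5 (λ a b c d s → (s :* :- c) :* b :+ (s :* a) :* d := (a :* d :- b :* c) :* s) refl a b c d s

  adj-cancelʳ : ∀ B A → (B *M adj A) *M A ≈M detM A ·M B
  adj-cancelʳ (mat b₁ b₂ b₃ b₄) (mat x y z w) =
    row b₁ b₂ , row′ b₁ b₂ , row b₃ b₄ , row′ b₃ b₄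
    where
    row : ∀ u v → (u * w + v * - z) * x + (u * - y + v * x) * z ≈ (x * w - y * z) * u
    row u v = solve 6 (λ u v x y z w →
      (u :* w :+ v :* :- z) :* x :+ (u :* :- y :+ v :* x) :* z := (x :* w :- y :* z) :* u) refl u v x y z w
    row′ : ∀ u v → (u * w + v * - z) * y + (u * - y + v * x) * w ≈ (x * w - y * z) * v
    row′ u v = solve 6 (λ u v x y z w →
      (u :* w :+ v :* :- z) :* y :+ (u :* :- y :+ v :* x) :* w := (x :* w :- y :* z) :* v) refl u v x y z w

  *M-affine : ∀ A a t G → A *M affine a t G ≈M a ·M A +M t ·M (A *M G)
  *M-affine (mat x y z w) a t (mat g₁ g₂ g₃ g₄) =
    column₁ x y g₁ g₃ , column₂ x y g₂ g₄ , column₁ z w g₁ g₃ , column₂ z w g₂ g₄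
    where
    column₁ : ∀ u v g g′ → u * (a + g * t) + v * (g′ * t) ≈ a * u + t * (u * g + v * g′)
    column₁ u v g g′ = solve 6 (λ u v g g′ a t →
      u :* (a :+ g :* t) :+ v :* (g′ :* t) := a :* u :+ t :* (u :* g :+ v :* g′)) refl u v g g′ a t
    column₂ : ∀ u v g g′ → u * (g * t) + v * (a + g′ * t) ≈ a * v + t * (u * g + v * g′)
    column₂ u v g g′ = solve 6 (λ u v g g′ a t →
      u :* (g :* t) :+ v :* (a :+ g′ :* t) := a :* v :+ t :* (u :* g :+ v :* g′)) refl u v g g′ a t

  affine-*M : ∀ a s B A → affine a s B *M A ≈M a ·M A +M s ·M (B *M A)
  affine-*M a s (mat b₁ b₂ b₃ b₄) (mat x y z w) =
    row₁ b₁ b₂ x z , row₁ b₁ b₂ y w , row₂ b₃ b₄ x z , row₂ b₃ b₄ y w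
    where
    row₁ : ∀ b b′ u v → (a + b * s) * u + (b′ * s) * v ≈ a * u + s * (b * u + b′ * v)
    row₁ b b′ u v = solve 6 (λ b b′ u v a s →
      (a :+ b :* s) :* u :+ (b′ :* s) :* v := a :* u :+ s :* (b :* u :+ b′ :* v)) refl b b′ u v a s
    row₂ : ∀ b b′ u v → (b * s) * u + (a + b′ * s) * v ≈ a * v + s * (b * u + b′ * v)
    row₂ b b′ u v = solve 6 (λ b b′ u v a s →
      (b :* s) :* u :+ (a :+ b′ :* s) :* v := a :* v :+ s :* (b :* u :+ b′ :* v)) refl b b′ u v a s

  conjugate-affine : ∀ α a s t G → s * detM α ≈ t →
                     α *M affine a t G ≈M affine a s ((α *M G) *M adj α) *M α
  conjugate-affine α a s t G s·detα≈t = begin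
    α *M affine a t G                                     ≈⟨ *M-affine α a t G ⟩
    a ·M α +M t ·M (α *M G)                               ≈⟨ +M-congˡ (·M-congˡ (α *M G) s·detα≈t) ⟨
    a ·M α +M (s * detM α) ·M (α *M G)                    ≈⟨ +M-congˡ (·M-assoc s (detM α) (α *M G)) ⟨
    a ·M α +M s ·M (detM α ·M (α *M G))                   ≈⟨ +M-congˡ (·M-congʳ s (adj-cancelʳ (α *M G) α)) ⟨
    a ·M α +M s ·M (((α *M G) *M adj α) *M α)             ≈⟨ affine-*M a s ((α *M G) *M adj α) α ⟨
    affine a s ((α *M G) *M adj α) *M α                   ∎
    where open ≈M-Reasoning

  det-affine : ∀ a t G → detM (affine a t G) ≈ a * a + t * (a * (m₁₁ G + m₂₂ G) + t * detM G)
  det-affine a t (mat g₁ g₂ g₃ g₄) = solve 6 (λ a t g₁ g₂ g₃ g₄ →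
    (a :+ g₁ :* t) :* (a :+ g₄ :* t) :- (g₂ :* t) :* (g₃ :* t)
      := a :* a :+ t :* (a :* (g₁ :+ g₄) :+ t :* (g₁ :* g₄ :- g₂ :* g₃))) refl a t g₁ g₂ g₃ g₄

  scaled-adj-affine : ∀ s a t G → s ·M adj (affine a t G) ≈M affine (s * a) t (s ·M adj G)
  scaled-adj-affine s a t (mat g₁ g₂ g₃ g₄) =
    diagonal g₄ , offDiagonal g₂ , offDiagonal g₃ , diagonal g₁
    where
    diagonal : ∀ g → s * (a + g * t) ≈ s * a + (s * g) * t
    diagonal g = solve 4 (λ s a g t → s :* (a :+ g :* t) := s :* a :+ (s :* g) :* t) refl s a g t
    offDiagonal : ∀ g → s * - (g * t) ≈ (s * - g) * t
    offDiagonal g = solve 3 (λ s g t → s :* :- (g :* t) := (s :* :- g) :* t) refl s g t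

module Units {c ℓ : Level} (R : CommutativeRing c ℓ) where
  open CommutativeRing R
  open IntegerSolver R

  unit-resp : ∀ {x y} → x ≈ y → IsUnit R x → IsUnit R y
  unit-resp x≈y (v , xv≈1) = v , trans (*-congʳ (sym x≈y)) xv≈1

  unit-* : ∀ {x y} → IsUnit R x → IsUnit R y → IsUnit R (x * y)
  unit-* {x} {y} (v , xv≈1) (w , yw≈1) = v * w , (begin
    (x * y) * (v * w)   ≈⟨ solve 4 (λ x y v w → (x :* y) :* (v :* w) := (x :* v) :* (y :* w)) refl x y v w ⟩
    (x * v) * (y * w)   ≈⟨ *-cong xv≈1 yw≈1 ⟩
    1# * 1#             ≈⟨ *-identityʳ 1# ⟩
    1#                  ∎)
    where open SetoidReasoning setoid

  unit-factor : ∀ {x y} → IsUnit R (x * y) → IsUnit R x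
  unit-factor {x} {y} (v , xyv≈1) = y * v , trans (sym (*-assoc x y v)) xyv≈1

module Order𝒪 {c ℓ : Level} (R : CommutativeRing c ℓ) (p : CommutativeRing.Carrier R) (n : ℕ) where
  open CommutativeRing R
  open IntegerSolver R
  open Matrices R
  open Order R p n

  pⁿ : Carrier
  pⁿ = pow R p n

  In𝒪-resp : ∀ {A B} → A ≈M B → In𝒪 B → In𝒪 A
  In𝒪-resp (_ , _ , A₂₁≈B₂₁ , _) (r , B₂₁≈pⁿr) = r , trans A₂₁≈B₂₁ B₂₁≈pⁿr

  1∈𝒪 : In𝒪 1M
  1∈𝒪 = 0# , sym (zeroʳ pⁿ)

  *∈𝒪 : ∀ A B → In𝒪 A → In𝒪 B → In𝒪 (A *M B)
  *∈𝒪 (mat a₁ a₂ a₃ a₄) (mat b₁ b₂ b₃ b₄) (r , a₃≈) (s , b₃≈) = r * b₁ + a₄ * s , (begin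
    a₃ * b₁ + a₄ * b₃               ≈⟨ +-cong (*-congʳ a₃≈) (*-congˡ b₃≈) ⟩
    (pⁿ * r) * b₁ + a₄ * (pⁿ * s)   ≈⟨ solve 5 (λ P r b a s → (P :* r) :* b :+ a :* (P :* s) := P :* (r :* b :+ a :* s))
                                              refl pⁿ r b₁ a₄ s ⟩
    pⁿ * (r * b₁ + a₄ * s)          ∎)
    where open ≈-Reasoning

  ·∈𝒪 : ∀ s A → In𝒪 A → In𝒪 (s ·M A)
  ·∈𝒪 s A (r , A₂₁≈pⁿr) =
    s * r , trans (*-congˡ A₂₁≈pⁿr) (solve 3 (λ s P r → s :* (P :* r) := P :* (s :* r)) refl s pⁿ r)

  adj∈𝒪 : ∀ A → In𝒪 A → In𝒪 (adj A)
  adj∈𝒪 A (r , A₂₁≈pⁿr) = - r , trans (-‿cong A₂₁≈pⁿr) (-‿distribʳ-* pⁿ r)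
    where open import Algebra.Properties.Ring ring using (-‿distribʳ-*)

  affine∈𝒪 : ∀ a t G → In𝒪 G → In𝒪 (affine a t G)
  affine∈𝒪 a t G (r , G₂₁≈pⁿr) = r * t , trans (*-congʳ G₂₁≈pⁿr) (*-assoc pⁿ r t)

  invertible-in-𝒪 : ∀ {A s} → In𝒪 A → detM A * s ≈ 1# → Unit𝒪 A
  invertible-in-𝒪 {A} {s} A∈𝒪 detA·s≈1 =
    A∈𝒪 , s ·M adj A , ·∈𝒪 s (adj A) (adj∈𝒪 A A∈𝒪) ,
    ≈M-trans (*M-adj s A) scalar≈1 , ≈M-trans (adj-*M s A) scalar≈1
    where
    scalar≈1 : scalarM (detM A * s) ≈M 1M
    scalar≈1 = detA·s≈1 , refl , refl , detA·s≈1

  -- "α ω ∈ 𝒪 α", i.e. α ω α⁻¹ ∈ 𝒪.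
  αω∈𝒪α : Mat R → Mat R → Set (c ⊔ ℓ)
  αω∈𝒪α α ω = Σ (Mat R) λ o → In𝒪 o × α *M ω ≈M o *M α

  α∈𝒪α : ∀ α → Ideal𝒪 α α
  α∈𝒪α α = 1M , 1∈𝒪 , ≈M-sym (*M-identityˡ α)

  fixed⇒αω∈𝒪α : ∀ {α ω} → (∀ x → IdealTimes α ω x ⇔ₚ Ideal𝒪 α x) → αω∈𝒪α α ω
  fixed⇒αω∈𝒪α {α} {ω} fixes = proj₁ (fixes (α *M ω)) (α , α∈𝒪α α , ≈M-refl)

  αω∈𝒪α⇒fixed : ∀ {α ω ω′} → ω′ *M ω ≈M 1M → αω∈𝒪α α ω → αω∈𝒪α α ω′ →
                 ∀ x → IdealTimes α ω x ⇔ₚ Ideal𝒪 α x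
  αω∈𝒪α⇒fixed {α} {ω} {ω′} ω′ω≈1 (o₁ , o₁∈𝒪 , αω≈o₁α) (o₂ , o₂∈𝒪 , αω′≈o₂α) x = into , onto
    where
    open ≈M-Reasoning
    into : IdealTimes α ω x → Ideal𝒪 α x
    into (y , (o , o∈𝒪 , y≈oα) , x≈yω) = o *M o₁ , *∈𝒪 o o₁ o∈𝒪 o₁∈𝒪 , (begin
      x                    ≈⟨ x≈yω ⟩
      y *M ω               ≈⟨ *M-cong y≈oα ≈M-refl ⟩
      (o *M α) *M ω        ≈⟨ *M-assoc o α ω ⟩
      o *M (α *M ω)        ≈⟨ *M-cong ≈M-refl αω≈o₁α ⟩
      o *M (o₁ *M α)       ≈⟨ *M-assoc o o₁ α ⟨
      (o *M o₁) *M α       ∎)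
    onto : Ideal𝒪 α x → IdealTimes α ω x
    onto (o , o∈𝒪 , x≈oα) = (o *M o₂) *M α , (o *M o₂ , *∈𝒪 o o₂ o∈𝒪 o₂∈𝒪 , ≈M-refl) , (begin
      x                          ≈⟨ x≈oα ⟩
      o *M α                     ≈⟨ *M-cong ≈M-refl (*M-identityʳ α) ⟨
      o *M (α *M 1M)             ≈⟨ *M-cong ≈M-refl (*M-cong ≈M-refl ω′ω≈1) ⟨
      o *M (α *M (ω′ *M ω))      ≈⟨ *M-cong ≈M-refl (*M-assoc α ω′ ω) ⟨
      o *M ((α *M ω′) *M ω)      ≈⟨ *M-cong ≈M-refl (*M-cong αω′≈o₂α ≈M-refl) ⟩
      o *M ((o₂ *M α) *M ω)      ≈⟨ *M-cong ≈M-refl (*M-assoc o₂ α ω) ⟩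
      o *M (o₂ *M (α *M ω))      ≈⟨ *M-assoc o o₂ (α *M ω) ⟨
      (o *M o₂) *M (α *M ω)      ≈⟨ *M-assoc (o *M o₂) α ω ⟨
      ((o *M o₂) *M α) *M ω      ∎)

  affine⇒αω∈𝒪α : ∀ {α ω a s G} → In𝒪 α → In𝒪 G → s * detM α ≈ p → ω ≈M affine a p G → αω∈𝒪α α ω
  affine⇒αω∈𝒪α {α} {ω} {a} {s} {G} α∈𝒪 G∈𝒪 s·detα≈p ω≈a+Gp =
    affine a s ((α *M G) *M adj α) ,
    affine∈𝒪 a s ((α *M G) *M adj α) (*∈𝒪 (α *M G) (adj α) (*∈𝒪 α G α∈𝒪 G∈𝒪) (adj∈𝒪 α α∈𝒪)) ,
    ≈M-trans (*M-cong ≈M-refl ω≈a+Gp) (conjugate-affine α a s p G s·detα≈p)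

  nrd-divides-p : ∀ {α} → NrdIsP α → Σ Carrier λ s → s * detM α ≈ p
  nrd-divides-p {α} nrd with proj₂ (nrd p) (1# , sym (*-identityʳ p))
  ... | s , p≈detα·s = s , trans (*-comm s (detM α)) (sym p≈detα·s)

  -- A sufficient criterion for 𝒪α ∈ Id(𝒪;𝔭)′: det α = p, and 1 - α is
  -- singular, so that α cannot lie in the Jacobson radical.
  InId′-criterion : ¬ (1# ≈ 0#) → ∀ {α} → In𝒪 α → detM α ≈ p →
                    detM (1M -M (1M *M α)) ≈ 0# → InId' α
  InId′-criterion 1≉0 {α} α∈𝒪 detα≈p det[1-α]≈0 = α∈𝒪 , nrd≈𝔭 , λ _ → not-radical
    where
    nrd≈𝔭 : NrdIsP α
    nrd≈𝔭 x = (λ { (r , x≈detα·r) → r , trans x≈detα·r (*-congʳ detα≈p) })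
            , (λ { (r , x≈p·r) → r , trans x≈p·r (*-congʳ (sym detα≈p)) })
    not-radical : ¬ (∀ x → Ideal𝒪 α x ⇔ₚ Rad x)
    not-radical 𝒪α≡rad with proj₂ (proj₁ (𝒪α≡rad α) (α∈𝒪α α)) 1M 1∈𝒪
    ... | _ , _ , _ , [1-α]B≈1 , _ = singular-no-inverse 1≉0 det[1-α]≈0 [1-α]B≈1

  InRˣ+p𝒪 : Mat R → Set (c ⊔ ℓ)
  InRˣ+p𝒪 ω = Σ Carrier λ a → IsUnit R a × Σ (Mat R) λ G → In𝒪 G × ω ≈M affine a p G

  KerShape⇒Rˣ+p𝒪 : ∀ {ω} → KerShape ω → InRˣ+p𝒪 ω
  KerShape⇒Rˣ+p𝒪 (a , a-unit , b , c′ , k₁ , k₂ , ω≈) =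
    a , a-unit , mat k₁ b (c′ * pⁿ) k₂ , (c′ , *-comm c′ pⁿ) ,
    ≈M-trans ω≈ (refl , refl , lower-left , refl)
    where
    lower-left : c′ * (p * pⁿ) ≈ (c′ * pⁿ) * p
    lower-left = solve 3 (λ c′ p P → c′ :* (p :* P) := (c′ :* P) :* p) refl c′ p pⁿ

  Rˣ+p𝒪⇒KerShape : ∀ {ω} → InRˣ+p𝒪 ω → KerShape ω
  Rˣ+p𝒪⇒KerShape (a , a-unit , mat g₁ g₂ g₃ g₄ , (r , g₃≈pⁿr) , ω≈) =
    a , a-unit , g₂ , r , g₁ , g₄ ,
    ≈M-trans ω≈ (refl , refl , trans (*-congʳ g₃≈pⁿr) lower-left , refl)
    where
    lower-left : (pⁿ * r) * p ≈ r * (p * pⁿ)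
    lower-left = solve 3 (λ P r p → (P :* r) :* p := r :* (p :* P)) refl pⁿ r p

-- Units of a discrete valuation ring are stable under adding multiples of
-- the uniformizer (R is local with maximal ideal pR).
module LocalUnits {c ℓ : Level} (R : CommutativeRing c ℓ) (p : CommutativeRing.Carrier R)
                  (dvr : IsCompleteDVR R p) where
  open CommutativeRing R
  open IntegerSolver R
  open IsCompleteDVR dvr using (valuation; p-nonunit)
  open SetoidReasoning setoid

  -- By the valuation, u + pt is 0, a unit times p⁰, or a unit times pᵏ⁺¹;
  -- the first and the last case would make p a unit.

  unit+𝔭 : ∀ {u} t → IsUnit R u → IsUnit R (u + p * t)
  unit+𝔭 {u} t (v , uv≈1) with valuation (u + p * t)
  ... | inj₁ u+pt≈0 = ⊥-elim (p-nonunit (- (t * v) , (begin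
    p * - (t * v)              ≈⟨ solve 4 (λ p t u v → p :* :- (t :* v) := u :* v :- (u :+ p :* t) :* v)
                                           refl p t u v ⟩
    u * v - (u + p * t) * v    ≈⟨ +-cong uv≈1 (-‿cong (*-congʳ u+pt≈0)) ⟩
    1# - 0# * v                ≈⟨ solve 1 (λ v → 𝟙 :- 𝟘 :* v := 𝟙) refl v ⟩
    1#                         ∎)))
  ... | inj₂ (w , zero , (w′ , ww′≈1) , u+pt≈w) = w′ , (begin
    (u + p * t) * w′           ≈⟨ *-congʳ (trans u+pt≈w (*-identityʳ w)) ⟩
    w * w′                     ≈⟨ ww′≈1 ⟩
    1#                         ∎)
  ... | inj₂ (w , suc k , _ , u+pt≈wpᵏ⁺¹) = ⊥-elim (p-nonunit ((w * pᵏ - t) * v , (begin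
    p * ((w * pᵏ - t) * v)     ≈⟨ solve 5 (λ p w q t v → p :* ((w :* q :- t) :* v) := (w :* (p :* q) :- p :* t) :* v)
                                           refl p w pᵏ t v ⟩
    (w * (p * pᵏ) - p * t) * v ≈⟨ *-congʳ (+-congʳ (sym u+pt≈wpᵏ⁺¹)) ⟩
    ((u + p * t) - p * t) * v  ≈⟨ solve 4 (λ u p t v → ((u :+ p :* t) :- p :* t) :* v := u :* v) refl u p t v ⟩
    u * v                      ≈⟨ uv≈1 ⟩
    1#                         ∎)))
    where
    pᵏ : Carrier
    pᵏ = pow R p k

module Kernel {c ℓ : Level} (R : CommutativeRing c ℓ) (p : CommutativeRing.Carrier R)
              (dvr : IsCompleteDVR R p) (n : ℕ) (1≤n : 1 ≤ n) where
  open CommutativeRing R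
  open IntegerSolver R
  open IsCompleteDVR dvr using (nontrivial)
  open Matrices R
  open Units R
  open LocalUnits R p dvr
  open Order R p n
  open Order𝒪 R p n
  open SetoidReasoning setoid

  pⁿ∈𝔭 : Σ Carrier λ q → pⁿ ≈ p * q
  pⁿ∈𝔭 = positive-power 1≤n
    where
    positive-power : ∀ {k} → 1 ≤ k → Σ Carrier λ q → pow R p k ≈ p * q
    positive-power {suc k} _ = pow R p k , refl

  -- The upper-left entry of a unit of 𝒪 is a unit of R: from ω B = 1 we get
  -- a B₁₁ = 1 - b B₂₁ ∈ 1 + 𝔭, as B₂₁ ∈ 𝔭ⁿ ⊆ 𝔭.
  corner-unit : ∀ {ω} → Unit𝒪 ω → IsUnit R (m₁₁ ω)
  corner-unit {mat a b _ _} (_ , mat B₁ _ B₃ _ , (r , B₃≈pⁿr) , (ωB₁₁≈1 , _) , _) =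
    unit-factor (unit-resp 1+𝔭∋aB₁ (unit+𝔭 (- (b * (q * r))) (1# , *-identityʳ 1#)))
    where
    q : Carrier
    q = proj₁ pⁿ∈𝔭
    1+𝔭∋aB₁ : 1# + p * - (b * (q * r)) ≈ a * B₁
    1+𝔭∋aB₁ = sym (begin
      a * B₁                        ≈⟨ solve 4 (λ a B₁ b B₃ → a :* B₁ := (a :* B₁ :+ b :* B₃) :- b :* B₃)
                                              refl a B₁ b B₃ ⟩
      (a * B₁ + b * B₃) - b * B₃    ≈⟨ +-cong ωB₁₁≈1 (-‿cong (*-congˡ (trans B₃≈pⁿr (*-congʳ (proj₂ pⁿ∈𝔭))))) ⟩
      1# - b * ((p * q) * r)        ≈⟨ solve 4 (λ b p q r → 𝟙 :- b :* ((p :* q) :* r) := 𝟙 :+ p :* :- (b :* (q :* r)))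
                                              refl b p q r ⟩
      1# + p * - (b * (q * r))      ∎)

  upper : Carrier → Carrier → Carrier → Mat R
  upper x y w = mat x y 0# w

  upper∈Id′ : ∀ x y w → x * w ≈ p → (1# - x) * (1# - w) ≈ 0# → InId' (upper x y w)
  upper∈Id′ x y w xw≈p [1-x][1-w]≈0 =
    InId′-criterion nontrivial (0# , sym (zeroʳ pⁿ)) (trans det-upper xw≈p) (trans det-1-upper [1-x][1-w]≈0)
    where
    det-upper : detM (upper x y w) ≈ x * w
    det-upper = solve 3 (λ x y w → x :* w :- y :* 𝟘 := x :* w) refl x y w
    det-1-upper : detM (1M -M (1M *M upper x y w)) ≈ (1# - x) * (1# - w)
    det-1-upper = solve 3 (λ x y w →
      (𝟙 :- (𝟙 :* x :+ 𝟘 :* 𝟘)) :* (𝟙 :- (𝟘 :* y :+ 𝟙 :* w))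
        :- (𝟘 :- (𝟙 :* y :+ 𝟘 :* w)) :* (𝟘 :- (𝟘 :* x :+ 𝟙 :* 𝟘))
        := (𝟙 :- x) :* (𝟙 :- w)) refl x y w

  α₁ α₂ α₃ : Mat R
  α₁ = upper p 0# 1#
  α₂ = upper 1# 0# p
  α₃ = upper 1# 1# p

  α₁∈Id′ : InId' α₁
  α₁∈Id′ = upper∈Id′ p 0# 1# (*-identityʳ p) (solve 1 (λ p → (𝟙 :- p) :* (𝟙 :- 𝟙) := 𝟘) refl p)

  α₂∈Id′ : InId' α₂
  α₂∈Id′ = upper∈Id′ 1# 0# p (*-identityˡ p) (solve 1 (λ p → (𝟙 :- 𝟙) :* (𝟙 :- p) := 𝟘) refl p)

  α₃∈Id′ : InId' α₃
  α₃∈Id′ = upper∈Id′ 1# 1# p (*-identityˡ p) (solve 1 (λ p → (𝟙 :- 𝟙) :* (𝟙 :- p) := 𝟘) refl p)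

  lower-left∈𝔭ⁿ⁺¹ : ∀ {a b c d} → αω∈𝒪α α₁ (mat a b c d) → Σ Carrier λ r → c ≈ (pⁿ * r) * p
  lower-left∈𝔭ⁿ⁺¹ {a} {c = c} (mat _ _ o₃ o₄ , (r , o₃≈pⁿr) , (_ , _ , e₂₁ , _)) = r , (begin
    c                  ≈⟨ solve 2 (λ a c → c := 𝟘 :* a :+ 𝟙 :* c) refl a c ⟩
    0# * a + 1# * c    ≈⟨ e₂₁ ⟩
    o₃ * p + o₄ * 0#   ≈⟨ solve 3 (λ o₃ o₄ p → o₃ :* p :+ o₄ :* 𝟘 := o₃ :* p) refl o₃ o₄ p ⟩
    o₃ * p             ≈⟨ *-congʳ o₃≈pⁿr ⟩
    (pⁿ * r) * p       ∎)

  upper-right∈𝔭 : ∀ {a b c d} → αω∈𝒪α α₂ (mat a b c d) → Σ Carrier λ q → b ≈ q * p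
  upper-right∈𝔭 {b = b} {d = d} (mat o₁ o₂ _ _ , _ , (_ , e₁₂ , _ , _)) = o₂ , (begin
    b                  ≈⟨ solve 2 (λ b d → b := 𝟙 :* b :+ 𝟘 :* d) refl b d ⟩
    1# * b + 0# * d    ≈⟨ e₁₂ ⟩
    o₁ * 0# + o₂ * p   ≈⟨ solve 3 (λ o₁ o₂ p → o₁ :* 𝟘 :+ o₂ :* p := o₂ :* p) refl o₁ o₂ p ⟩
    o₂ * p             ∎)

  diagonal-congruence : ∀ {a b c d} → αω∈𝒪α α₃ (mat a b c d) → Σ Carrier λ s → b + d ≈ (a + c) + s * p
  diagonal-congruence {a} {b} {c} {d} (mat o₁ o₂ _ _ , _ , (e₁₁ , e₁₂ , _ , _)) = o₂ , (begin
    b + d              ≈⟨ solve 2 (λ b d → b :+ d := 𝟙 :* b :+ 𝟙 :* d) refl b d ⟩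
    1# * b + 1# * d    ≈⟨ e₁₂ ⟩
    o₁ * 1# + o₂ * p   ≈⟨ +-congʳ o₁≈a+c ⟩
    (a + c) + o₂ * p   ∎)
    where
    o₁≈a+c : o₁ * 1# ≈ a + c
    o₁≈a+c = begin
      o₁ * 1#            ≈⟨ solve 2 (λ o₁ o₂ → o₁ :* 𝟙 := o₁ :* 𝟙 :+ o₂ :* 𝟘) refl o₁ o₂ ⟩
      o₁ * 1# + o₂ * 0#  ≈⟨ e₁₁ ⟨
      1# * a + 1# * c    ≈⟨ solve 2 (λ a c → 𝟙 :* a :+ 𝟙 :* c := a :+ c) refl a c ⟩
      a + c              ∎

  congruences⇒Rˣ+p𝒪 : ∀ {a b c d r q s} → IsUnit R a → c ≈ (pⁿ * r) * p → b ≈ q * p →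
                       b + d ≈ (a + c) + s * p → InRˣ+p𝒪 (mat a b c d)
  congruences⇒Rˣ+p𝒪 {a} {b} {c} {d} {r} {q} {s} a-unit c≈ b≈ b+d≈ =
    a , a-unit , mat 0# q (pⁿ * r) k , (r , refl) ,
    solve 2 (λ a p → a := a :+ 𝟘 :* p) refl a p , b≈ , c≈ , d≈
    where
    k : Carrier
    k = pⁿ * r + s - q
    d≈ : d ≈ a + k * p
    d≈ = begin
      d                                       ≈⟨ solve 2 (λ b d → d := (b :+ d) :- b) refl b d ⟩
      (b + d) - b                             ≈⟨ +-cong b+d≈ (-‿cong b≈) ⟩
      ((a + c) + s * p) - q * p               ≈⟨ +-congʳ (+-congʳ (+-congˡ c≈)) ⟩
      ((a + (pⁿ * r) * p) + s * p) - q * p    ≈⟨ solve 6 (λ a P r p s q →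
                                                   ((a :+ (P :* r) :* p) :+ s :* p) :- q :* p := a :+ (P :* r :+ s :- q) :* p)
                                                   refl a pⁿ r p s q ⟩
      a + k * p                               ∎

  kernel⇒Rˣ+p𝒪 : ∀ ω → InKer ω → InRˣ+p𝒪 ω
  kernel⇒Rˣ+p𝒪 ω (ω∈𝒪ˣ , fixes) =
    congruences⇒Rˣ+p𝒪 (corner-unit ω∈𝒪ˣ)
      (proj₂ (lower-left∈𝔭ⁿ⁺¹ (fixed⇒αω∈𝒪α (fixes α₁ α₁∈Id′))))
      (proj₂ (upper-right∈𝔭 (fixed⇒αω∈𝒪α (fixes α₂ α₂∈Id′))))
      (proj₂ (diagonal-congruence (fixed⇒αω∈𝒪α (fixes α₃ α₃∈Id′))))

  Rˣ+p𝒪⇒kernel : ∀ {ω} → InRˣ+p𝒪 ω → InKer ω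
  Rˣ+p𝒪⇒kernel {ω} (a , a-unit , G , G∈𝒪 , ω≈a+Gp) = ω∈𝒪ˣ , fixes
    where
    detω-unit : IsUnit R (detM ω)
    detω-unit = unit-resp (trans (sym (det-affine a p G)) (det-cong (≈M-sym ω≈a+Gp)))
                          (unit+𝔭 _ (unit-* a-unit a-unit))
    e : Carrier
    e = proj₁ detω-unit
    ω∈𝒪ˣ : Unit𝒪 ω
    ω∈𝒪ˣ = invertible-in-𝒪 (In𝒪-resp ω≈a+Gp (affine∈𝒪 a p G G∈𝒪)) (proj₂ detω-unit)
    ω⁻¹ω≈1 : (e ·M adj ω) *M ω ≈M 1M
    ω⁻¹ω≈1 = proj₂ (proj₂ (proj₂ (proj₂ ω∈𝒪ˣ)))
    ω⁻¹≈ : e ·M adj ω ≈M affine (e * a) p (e ·M adj G)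
    ω⁻¹≈ = ≈M-trans (·M-congʳ e (adj-cong ω≈a+Gp)) (scaled-adj-affine e a p G)
    fixes : ∀ α → InId' α → ∀ x → IdealTimes α ω x ⇔ₚ Ideal𝒪 α x
    fixes α (α∈𝒪 , nrd≈𝔭 , _) with nrd-divides-p nrd≈𝔭
    ... | s , s·detα≈p =
      αω∈𝒪α⇒fixed ω⁻¹ω≈1 (affine⇒αω∈𝒪α α∈𝒪 G∈𝒪 s·detα≈p ω≈a+Gp)
        (affine⇒αω∈𝒪α α∈𝒪 (·∈𝒪 e (adj G) (adj∈𝒪 G G∈𝒪)) s·detα≈p ω⁻¹≈)

theorem5p4 : {c ℓ : Level} (R : CommutativeRing c ℓ) (p : CommutativeRing.Carrier R) →
             IsCompleteDVR R p → (n : ℕ) → 1 ≤ n → (ω : Mat R) →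
             Order.InKer R p n ω ⇔ₚ Order.KerShape R p n ω
theorem5p4 R p dvr n 1≤n ω =
  (λ ω∈ker → Rˣ+p𝒪⇒KerShape (kernel⇒Rˣ+p𝒪 ω ω∈ker)) ,
  (λ shape → Rˣ+p𝒪⇒kernel (KerShape⇒Rˣ+p𝒪 shape))
  where
  open Order𝒪 R p n
  open Kernel R p dvr n 1≤n
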